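{- Let $n\ge1$, $0\le h\le n-1$, $q=\max\{e^{ -e^{ -h/n}}-h/n,0\}$ with $qn$ an integer, and run Algorithm 3 in the $h$-RO-SP. For every $\ell$ with $qn+1\le\ell\le n-h$ and every $U_\ell\subseteq C$ with $|U_\ell|=h+\ell$, $$\Pr\Big[\bigwedge_{k=qn+1}^{\ell}\neg\mathcal{M}_k\ \Big|\ S_\ell=U_\ell\Big]=\frac{h+qn}{h+\ell}.$$
   Context: The $h$-RO-SP, for integers $n\ge1$, $h\ge0$: an adversary picks a set $C$ of $n+h$ candidates with values in $\mathbb{R}_{\ge0}$ (totally ordered, ties broken consistently). A uniformly random $H\subseteq C$ of size $h$ is given to the player upfront together with $n$; the candidates of $O=C\setminus H$ arrive one by one in uniformly random order $c_1,\dots,c_n$, each irrevocably accepted or rejected on arrival; accepting terminates. $S_\ell=H\cup\{c_1,\dots,c_\ell\}$ and $\mathcal{M}_k$ is the event that $c_k$ is accepted by the algorithm. Probabilities are over $H$, the random order and the algorithm's randomness. Algorithm 3: $T_0\leftarrow H$. At round $\ell$: $T_\ell\leftarrow T_{\ell-1}\cup\{c_\ell\}$. If $\ell\le qn$, reject. Else if $|T_\ell|\le n$, accept and terminate iff $c_\ell=\max T_\ell$. Else draw a uniformly random $X_\ell\subseteq T_{\ell-1}$ of cardinality $n-1$ and accept and terminate iff $c_\ell>\max X_\ell$. -}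

module Defs where

open import Data.Nat as ℕ using (ℕ; zero; suc; _+_; _∸_; _≤_; _≤?_; _≤ᵇ_; _<ᵇ_)
open import Data.Bool using (Bool; true; false; if_then_else_; not; _∧_; _∨_)
open import Data.List as List using (List; []; _∷_; map; concatMap; take; drop; length; foldr; allFin; _++_)
open import Data.Fin using (Fin; toℕ)
open import Data.Fin.Subset using (Subset; ⁅_⁆; _∪_; ∣_∣; inside; outside; _∈_; ⊥)
open import Data.Fin.Subset.Properties using (_∈?_)
open import Data.Vec using ([]; _∷_)
open import Data.Vec.Properties using (≡-dec)
import Data.Bool.Properties as BoolP
open import Data.Rational as ℚ using (ℚ; 0ℚ; 1ℚ; _*_)
open import Data.Integer using (+_)
open import Relation.Nullary using (does)

filter : {A : Set} → (A → Bool) → List A → List A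
filter p [] = []
filter p (x ∷ xs) = if p x then x ∷ filter p xs else filter p xs

insertions : {A : Set} → A → List A → List (List A)
insertions x [] = (x ∷ []) ∷ []
insertions x (y ∷ ys) = (x ∷ y ∷ ys) ∷ map (y ∷_) (insertions x ys)

perms : {A : Set} → List A → List (List A)
perms [] = [] ∷ []
perms (x ∷ xs) = concatMap (insertions x) (perms xs)

allSubsets : (N : ℕ) → List (Subset N)
allSubsets zero = [] ∷ []
allSubsets (suc N) = map (inside ∷_) (allSubsets N) ++ map (outside ∷_) (allSubsets N)

setOf : {N : ℕ} → List (Fin N) → Subset N
setOf = foldr (λ x s → ⁅ x ⁆ ∪ s) ⊥

_≟ˢ_ : {N : ℕ} → (A B : Subset N) → Bool
A ≟ˢ B = does (≡-dec BoolP._≟_ A B)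

memb : {N : ℕ} → Fin N → Subset N → Bool
memb x A = does (x ∈? A)

allIn : {N : ℕ} → Subset N → (Fin N → Bool) → Bool
allIn {N} A p = List.foldr _∧_ true (map (λ x → not (memb x A) ∨ p x) (allFin N))

subᵇ : {N : ℕ} → Subset N → Subset N → Bool
subᵇ A B = allIn A (λ x → memb x B)

isMax : {N : ℕ} → Fin N → Subset N → Bool
isMax c T = allIn T (λ x → toℕ x ≤ᵇ toℕ c)

aboveAll : {N : ℕ} → Fin N → Subset N → Bool
aboveAll c X = allIn X (λ x → toℕ x <ᵇ toℕ c)

-- a / b as a rational (b = 0 gives 0; never used with b = 0)
frac : ℕ → ℕ → ℚ
frac a zero = 0ℚ
frac a (suc b) = (+ a) ℚ./ suc b

fromℕ : ℕ → ℚ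
fromℕ a = (+ a) ℚ./ 1

sumℚ : List ℚ → ℚ
sumℚ = foldr ℚ._+_ 0ℚ

-- Probability that Algorithm 3 (threshold m = qn, parameter n) rejects
-- c at round k, given T_{k-1} = Tprev.
-- The possible draws X_k : subsets of T_{k-1} of cardinality n - 1 (uniform).
draws : {N : ℕ} → ℕ → Subset N → List (Subset N)
draws {N} n Tprev = filter (λ X → subᵇ X Tprev ∧ (∣ X ∣ ℕ.≡ᵇ (n ∸ 1))) (allSubsets N)

rejectProb : {N : ℕ} → (n m : ℕ) → Subset N → Fin N → ℕ → ℚ
rejectProb n m Tprev c k =
  if k ≤ᵇ m then 1ℚ
  else if ∣ ⁅ c ⁆ ∪ Tprev ∣ ≤ᵇ n
       then (if isMax c (⁅ c ⁆ ∪ Tprev) then 0ℚ else 1ℚ)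
       else frac (length (filter (λ X → not (aboveAll c X)) (draws n Tprev)))
                 (length (draws n Tprev))

-- Probability (over the algorithm's own randomness, fresh draws each round)
-- that none of the arrivals at rounds k, k+1, ..., (k + r - 1) is accepted,
-- given the set T of previously seen candidates and the remaining arrivals.
survive : {N : ℕ} → (n m : ℕ) → ℕ → Subset N → List (Fin N) → ℕ → ℚ
survive n m k T [] r = 1ℚ
survive n m k T (c ∷ cs) zero = 1ℚ
survive n m k T (c ∷ cs) (suc r) =
  rejectProb n m T c k * survive n m (suc k) (⁅ c ⁆ ∪ T) cs r

-- A uniformly random ordering w of the candidates C = Fin (n + h):
-- H = first h entries of w, c_1, ..., c_n = remaining entries in order.
arrangements : (n h : ℕ) → List (List (Fin (n + h)))
arrangements n h = perms (allFin (n + h))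

-- S_ℓ = H ∪ {c_1, ..., c_ℓ}
Sset : {N : ℕ} → (h ℓ : ℕ) → List (Fin N) → Subset N
Sset h ℓ w = setOf (take (h + ℓ) w)

-- Number of orderings with S_ℓ = U  (proportional to Pr[S_ℓ = U]).
countS : (n h ℓ : ℕ) → Subset (n + h) → ℕ
countS n h ℓ U = length (filter (λ w → Sset h ℓ w ≟ˢ U) (arrangements n h))

-- Sum over orderings with S_ℓ = U of Pr[no acceptance at rounds 1..ℓ | ordering]
-- (proportional to Pr[⋀_{k=m+1}^{ℓ} ¬M_k ∧ S_ℓ = U]).
survSum : (n h m ℓ : ℕ) → Subset (n + h) → ℚ
survSum n h m ℓ U =
  sumℚ (map (λ w → if Sset h ℓ w ≟ˢ U
                   then survive n m 1 (setOf (take h w)) (drop h w) ℓ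
                   else 0ℚ)
            (arrangements n h))

module Submission where

-- Write m = qn and let z be the largest element of U.  The proof has two halves.
--  * Survival is deterministic (Survival): rounds k ≤ m reject surely, and for
--    m < k ≤ ℓ we have |T_k| = h + k ≤ n, so round k accepts iff c_k is the
--    maximum of T_k.  Hence an ordering with S_ℓ = U survives rounds 1..ℓ iff
--    z ∈ S_m (survival-indicator), and survSum counts those orderings
--    (surviving-mass).
--  * The position of z is uniform (Counting): among the orderings of distinct
--    elements whose first L entries form U ∋ z, the fraction a / L has z among
--    the first a entries (position-uniform).  The proof is by induction on the
--    list, enumerating the orderings of x ∷ l as all insertions of x into the
--    orderings of l (Σ-perms-blocks).
-- The theorem combines the two with L = h + ℓ and a = h + m, embedded in ℚ.

open import Defs
open import Data.Bool using (Bool; true; false; T; if_then_else_; not; _∧_; _∨_)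
import Data.Bool.Properties as BoolP
open import Data.Fin using (Fin; zero; suc; toℕ; _≟_)
open import Data.Fin.Properties using (toℕ-injective)
open import Data.Fin.Subset
  using (Subset; ⁅_⁆; _∪_; ∣_∣; inside; outside; _∈_; _∉_; _-_; _─_; _⊆_; Nonempty)
open import Data.Fin.Subset.Properties
  using ( _∈?_; x∈p∪q⁻; x∈p∪q⁺; x∈⁅x⁆; x∈⁅y⁆⇒x≡y; ∉⊥; ⊆-antisym; x∈p∧x≢y⇒x∈p-y; p─q⊆p
        ; ∪-identityˡ; ∪-assoc; ∪-comm; ∣p∣≤∣x∷p∣; ∣⊥∣≡0; nonempty?; Empty-unique)
import Data.Integer as ℤ
import Data.Integer.Properties as ℤP
open import Data.List using (List; []; _∷_; map; concatMap; take; drop; length; allFin; _++_)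
import Data.List.Properties as ListP
open import Data.List.Membership.Propositional using () renaming (_∈_ to _∈ˡ_; _∉_ to _∉ˡ_)
open import Data.List.Membership.Propositional.Properties using (∈-allFin; ∈-++⁺ˡ; ∈-++⁺ʳ)
open import Data.List.Relation.Binary.Permutation.Propositional
  using (_↭_; prep; swap; ↭-sym; ↭⇒↭ₛ) renaming (refl to ↭-refl; trans to ↭-trans)
open import Data.List.Relation.Binary.Permutation.Propositional.Properties using (∈-resp-↭; ↭-length)
import Data.List.Relation.Binary.Permutation.Setoid.Properties as PermSetoid
open import Data.List.Relation.Unary.All as All using (All; []; _∷_)
import Data.List.Relation.Unary.All.Properties as AllP
open import Data.List.Relation.Unary.Any using (here; there)
open import Data.List.Relation.Unary.AllPairs using (_∷_)
open import Data.List.Relation.Unary.Unique.Propositional using (Unique)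
open import Data.List.Relation.Unary.Unique.Propositional.Properties using (allFin⁺; Unique[x∷xs]⇒x∉xs)
open import Data.Nat as ℕ using (ℕ; zero; suc; _+_; _∸_; _≤_; _<_; z≤n; s≤s; _≤ᵇ_; _≤?_)
import Data.Nat.Properties as ℕP
import Data.Nat.Coprimality as Coprime
open import Data.Nat.Tactic.RingSolver using (solve-∀)
open import Data.Product using (Σ; _×_; _,_; proj₁)
open import Data.Rational as ℚ using (ℚ; mkℚ; 0ℚ; 1ℚ)
import Data.Rational.Properties as ℚP
open import Data.Sum using (_⊎_; inj₁; inj₂)
open import Data.Unit using (tt)
open import Data.Vec using ([]; _∷_)
open import Data.Vec.Base using () renaming (here to vhere; there to vthere)
open import Data.Vec.Properties using (≡-dec)
open import Function using (_∘_; _⇔_; mk⇔; Equivalence)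
open import Relation.Binary.PropositionalEquality
open import Relation.Nullary using (yes; no; ¬_)
open import Relation.Nullary.Decidable using (dec-true; dec-false; does-⇔)
open import Relation.Nullary.Negation using (contradiction)

private
  variable
    N : ℕ

memb-in : {x : Fin N} {A : Subset N} → x ∈ A → memb x A ≡ true
memb-in {x = x} {A} = dec-true (x ∈? A)

memb-out : {x : Fin N} {A : Subset N} → x ∉ A → memb x A ≡ false
memb-out {x = x} {A} = dec-false (x ∈? A)

memb-cong : {x : Fin N} {A B : Subset N} → (x ∈ A ⇔ x ∈ B) → memb x A ≡ memb x B
memb-cong {x = x} {A} {B} A⇔B = does-⇔ A⇔B (x ∈? A) (x ∈? B)

≟ˢ-false : {A B : Subset N} → ¬ A ≡ B → (A ≟ˢ B) ≡ false
≟ˢ-false {A = A} {B} = dec-false (≡-dec BoolP._≟_ A B)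

≟ˢ-sound : {A B : Subset N} → (A ≟ˢ B) ≡ true → A ≡ B
≟ˢ-sound {A = A} {B} e with ≡-dec BoolP._≟_ A B
... | yes A≡B = A≡B
≟ˢ-sound () | no _

≟ˢ-cong : {A B C D : Subset N} → (A ≡ B ⇔ C ≡ D) → (A ≟ˢ B) ≡ (C ≟ˢ D)
≟ˢ-cong {A = A} {B} {C} {D} e = does-⇔ e (≡-dec BoolP._≟_ A B) (≡-dec BoolP._≟_ C D)

allIn-sound : (A : Subset N) (p : Fin N → Bool) → allIn A p ≡ true → ∀ {x} → x ∈ A → p x ≡ true
allIn-sound {N} A p e {x} x∈A
  with Equivalence.to BoolP.T-≡ (All.lookup (AllP.all⁺ _ (allFin N) (subst T (sym e) tt)) (∈-allFin x))
... | holds rewrite memb-in x∈A = holds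

allIn-complete : (A : Subset N) (p : Fin N → Bool) → (∀ {x} → x ∈ A → p x ≡ true) → allIn A p ≡ true
allIn-complete {N} A p h = Equivalence.to BoolP.T-≡ (AllP.all⁻ _ (All.universal holds (allFin N)))
  where
  holds : ∀ x → T (not (memb x A) ∨ p x)
  holds x with x ∈? A
  ... | yes x∈A = Equivalence.from BoolP.T-≡ (h x∈A)
  ... | no _ = tt

≤ᵇ-true : {a b : ℕ} → a ≤ b → (a ≤ᵇ b) ≡ true
≤ᵇ-true a≤b = dec-true (_ ≤? _) a≤b

≤ᵇ-false : {a b : ℕ} → b < a → (a ≤ᵇ b) ≡ false
≤ᵇ-false b<a = dec-false (_ ≤? _) (ℕP.<⇒≱ b<a)

≤ᵇ-sound : {a b : ℕ} → (a ≤ᵇ b) ≡ true → a ≤ b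
≤ᵇ-sound {a} {b} e = ℕP.≤ᵇ⇒≤ a b (subst T (sym e) tt)

∈-⁅⁆∪⁻ : {x y : Fin N} (S : Subset N) → y ∈ ⁅ x ⁆ ∪ S → y ≡ x ⊎ y ∈ S
∈-⁅⁆∪⁻ {x = x} S p with x∈p∪q⁻ ⁅ x ⁆ S p
... | inj₁ y∈⁅x⁆ = inj₁ (x∈⁅y⁆⇒x≡y x y∈⁅x⁆)
... | inj₂ y∈S = inj₂ y∈S

∈-⁅⁆∪-here : (x : Fin N) (S : Subset N) → x ∈ ⁅ x ⁆ ∪ S
∈-⁅⁆∪-here x S = x∈p∪q⁺ (inj₁ (x∈⁅x⁆ x))

∈-⁅⁆∪-there : {y : Fin N} (x : Fin N) {S : Subset N} → y ∈ S → y ∈ ⁅ x ⁆ ∪ S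
∈-⁅⁆∪-there x y∈S = x∈p∪q⁺ (inj₂ y∈S)

memb-⁅⁆∪-other : {x z : Fin N} (S : Subset N) → ¬ z ≡ x → memb z (⁅ x ⁆ ∪ S) ≡ memb z S
memb-⁅⁆∪-other {x = x} {z} S z≢x = memb-cong (mk⇔ drop-x (∈-⁅⁆∪-there x))
  where
  drop-x : z ∈ ⁅ x ⁆ ∪ S → z ∈ S
  drop-x p with ∈-⁅⁆∪⁻ S p
  ... | inj₁ z≡x = contradiction z≡x z≢x
  ... | inj₂ z∈S = z∈S

∈-remove⁻ : {U : Subset N} {x y : Fin N} → y ∈ U - x → y ∈ U × ¬ y ≡ x
∈-remove⁻ {U = U} {x} p =
  p─q⊆p U ⁅ x ⁆ p , λ y≡x → not-removed U ⁅ x ⁆ p (subst (_∈ ⁅ x ⁆) (sym y≡x) (x∈⁅x⁆ x))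
  where
  not-removed : (p q : Subset N) {y : Fin N} → y ∈ p ─ q → y ∉ q
  not-removed (_ ∷ p) (outside ∷ q) vhere ()
  not-removed (_ ∷ p) (_ ∷ q) (vthere y∈p─q) (vthere y∈q) = not-removed p q y∈p─q y∈q

⁅⁆∪≡⇔≡remove : {x : Fin N} {S U : Subset N} → x ∉ S → x ∈ U → (⁅ x ⁆ ∪ S ≡ U) ⇔ (S ≡ U - x)
⁅⁆∪≡⇔≡remove {x = x} {S} {U} x∉S x∈U = mk⇔ to from
  where
  to : ⁅ x ⁆ ∪ S ≡ U → S ≡ U - x
  to refl = ⊆-antisym S⊆ ⊆S
    where
    S⊆ : S ⊆ U - x
    S⊆ {y} y∈S = x∈p∧x≢y⇒x∈p-y (∈-⁅⁆∪-there x y∈S) (λ y≡x → x∉S (subst (_∈ S) y≡x y∈S))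
    ⊆S : U - x ⊆ S
    ⊆S p with ∈-remove⁻ p
    ... | y∈U , y≢x with ∈-⁅⁆∪⁻ S y∈U
    ...   | inj₁ y≡x = contradiction y≡x y≢x
    ...   | inj₂ y∈S = y∈S
  from : S ≡ U - x → ⁅ x ⁆ ∪ S ≡ U
  from refl = ⊆-antisym ⊆U U⊆
    where
    ⊆U : ⁅ x ⁆ ∪ (U - x) ⊆ U
    ⊆U p with ∈-⁅⁆∪⁻ (U - x) p
    ... | inj₁ refl = x∈U
    ... | inj₂ q = proj₁ (∈-remove⁻ q)
    U⊆ : U ⊆ ⁅ x ⁆ ∪ (U - x)
    U⊆ {y} y∈U with y ≟ x
    ... | yes refl = ∈-⁅⁆∪-here x (U - x)
    ... | no y≢x = ∈-⁅⁆∪-there x (x∈p∧x≢y⇒x∈p-y y∈U y≢x)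

∣⁅⁆∪∣≤ : (x : Fin N) (S : Subset N) → ∣ ⁅ x ⁆ ∪ S ∣ ≤ suc ∣ S ∣
∣⁅⁆∪∣≤ zero (s ∷ S) rewrite ∪-identityˡ S = s≤s (∣p∣≤∣x∷p∣ s S)
∣⁅⁆∪∣≤ (suc x) (inside ∷ S) = s≤s (∣⁅⁆∪∣≤ x S)
∣⁅⁆∪∣≤ (suc x) (outside ∷ S) = ∣⁅⁆∪∣≤ x S

nonempty-of-card : (U : Subset N) → 0 < ∣ U ∣ → Nonempty U
nonempty-of-card {N} U 0<∣U∣ with nonempty? U
... | yes ne = ne
... | no empty = contradiction (trans (cong ∣_∣ (Empty-unique empty)) (∣⊥∣≡0 N)) (ℕP.>⇒≢ 0<∣U∣)

greatest : (U : Subset N) → Nonempty U → Σ (Fin N) (λ z → z ∈ U × (∀ {y} → y ∈ U → toℕ y ≤ toℕ z))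
greatest {suc N} (s ∷ U) (y , y∈) with nonempty? U
... | yes ne with greatest U ne
...   | z , z∈U , z-max = suc z , vthere z∈U , bound
  where
  bound : ∀ {y} → y ∈ s ∷ U → toℕ y ≤ toℕ (suc z)
  bound {zero} _ = z≤n
  bound {suc y} (vthere y∈U) = s≤s (z-max y∈U)
greatest {suc N} (s ∷ U) (zero , 0∈) | no empty = zero , 0∈ , bound
  where
  bound : ∀ {y} → y ∈ s ∷ U → toℕ y ≤ 0
  bound {zero} _ = z≤n
  bound {suc y} (vthere y∈U) = contradiction (y , y∈U) empty
greatest {suc N} (s ∷ U) (suc y , vthere y∈U) | no empty = contradiction (y , y∈U) empty

setOf⁻ : {y : Fin N} (v : List (Fin N)) → y ∈ setOf v → y ∈ˡ v
setOf⁻ [] p = contradiction p ∉⊥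
setOf⁻ (x ∷ v) p with ∈-⁅⁆∪⁻ (setOf v) p
... | inj₁ refl = here refl
... | inj₂ q = there (setOf⁻ v q)

setOf⁺ : {y : Fin N} (v : List (Fin N)) → y ∈ˡ v → y ∈ setOf v
setOf⁺ (x ∷ v) (here refl) = ∈-⁅⁆∪-here x (setOf v)
setOf⁺ (x ∷ v) (there p) = ∈-⁅⁆∪-there x (setOf⁺ v p)

∪-left-comm : (a b c : Subset N) → a ∪ (b ∪ c) ≡ b ∪ (a ∪ c)
∪-left-comm a b c = trans (sym (∪-assoc a b c)) (trans (cong (_∪ c) (∪-comm a b)) (∪-assoc b a c))

setOf-snoc : (v : List (Fin N)) (c : Fin N) → setOf (v ++ c ∷ []) ≡ ⁅ c ⁆ ∪ setOf v
setOf-snoc [] c = refl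
setOf-snoc (y ∷ v) c = trans (cong (⁅ y ⁆ ∪_) (setOf-snoc v c)) (∪-left-comm ⁅ y ⁆ ⁅ c ⁆ (setOf v))

∣setOf∣≤length : (v : List (Fin N)) → ∣ setOf v ∣ ≤ length v
∣setOf∣≤length {N} [] rewrite ∣⊥∣≡0 N = z≤n
∣setOf∣≤length (x ∷ v) = ℕP.≤-trans (∣⁅⁆∪∣≤ x (setOf v)) (s≤s (∣setOf∣≤length v))

prefix : ℕ → List (Fin N) → Subset N
prefix L w = setOf (take L w)

prefix-fresh : {x : Fin N} (L : ℕ) (w : List (Fin N)) → x ∉ˡ w → x ∉ prefix L w
prefix-fresh L w x∉w p = x∉w (take-⊆ L w (setOf⁻ (take L w) p))
  where
  take-⊆ : ∀ {y} (k : ℕ) (v : List (Fin N)) → y ∈ˡ take k v → y ∈ˡ v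
  take-⊆ (suc k) (x ∷ v) (here p) = here p
  take-⊆ (suc k) (x ∷ v) (there p) = there (take-⊆ k v p)

memb-prefix-0 : (z : Fin N) (w : List (Fin N)) → memb z (prefix 0 w) ≡ false
memb-prefix-0 z w = memb-out {x = z} ∉⊥

take-+ : {A : Set} (a b : ℕ) (w : List A) → take (a + b) w ≡ take a w ++ take b (drop a w)
take-+ zero b w = refl
take-+ (suc a) zero [] = refl
take-+ (suc a) (suc b) [] = refl
take-+ (suc a) b (x ∷ w) = cong (x ∷_) (take-+ a b w)

-- ins q x w inserts x at position q of w; perms (x ∷ l) (Defs) consists of
-- the insertions of x into the orderings of l.
ins : {A : Set} → ℕ → A → List A → List A
ins zero x w = x ∷ w
ins (suc q) x [] = x ∷ []
ins (suc q) x (y ∷ w) = y ∷ ins q x w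

setOf-ins : (q : ℕ) (x : Fin N) (v : List (Fin N)) → setOf (ins q x v) ≡ ⁅ x ⁆ ∪ setOf v
setOf-ins zero x v = refl
setOf-ins (suc q) x [] = refl
setOf-ins (suc q) x (y ∷ v) =
  trans (cong (⁅ y ⁆ ∪_) (setOf-ins q x v)) (∪-left-comm ⁅ y ⁆ ⁅ x ⁆ (setOf v))

prefix-ins-early : (q L : ℕ) (x : Fin N) (w : List (Fin N)) → q ≤ L →
                   prefix (suc L) (ins q x w) ≡ ⁅ x ⁆ ∪ prefix L w
prefix-ins-early q L x w q≤L = trans (cong setOf (take-ins q L w q≤L)) (setOf-ins q x (take L w))
  where
  take-ins : ∀ q L w → q ≤ L → take (suc L) (ins q x w) ≡ ins q x (take L w)
  take-ins zero L w _ = refl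
  take-ins (suc q) (suc L) [] _ = refl
  take-ins (suc q) (suc L) (y ∷ w) (s≤s q≤L) = cong (y ∷_) (take-ins q L w q≤L)

prefix-ins-late : (q L : ℕ) (x : Fin N) (w : List (Fin N)) → L ≤ q → q ≤ length w →
                  prefix L (ins q x w) ≡ prefix L w
prefix-ins-late q L x w L≤q q≤∣w∣ = cong setOf (take-ins q L w L≤q q≤∣w∣)
  where
  take-ins : ∀ q L w → L ≤ q → q ≤ length w → take L (ins q x w) ≡ take L w
  take-ins q zero w _ _ = refl
  take-ins (suc q) (suc L) (y ∷ w) (s≤s L≤q) (s≤s q≤∣w∣) = cong (y ∷_) (take-ins q L w L≤q q≤∣w∣)

-- Counting orderings.  Multiplication of naturals is opened only inside this
-- module, so that _*_ in the statement of the theorem is multiplication in ℚ.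
module Counting where

  open import Data.Nat using (_*_)
  open import Algebra.Properties.CommutativeSemigroup ℕP.*-commutativeSemigroup
    using () renaming (x∙yz≈y∙xz to *-left-comm)

  ind : Bool → ℕ
  ind true = 1
  ind false = 0

  Σl : {A : Set} → (A → ℕ) → List A → ℕ
  Σl f [] = 0
  Σl f (x ∷ xs) = f x + Σl f xs

  module _ {A : Set} where

    Σl-cong : {f g : A → ℕ} {xs : List A} → All (λ x → f x ≡ g x) xs → Σl f xs ≡ Σl g xs
    Σl-cong [] = refl
    Σl-cong (e ∷ es) = cong₂ _+_ e (Σl-cong es)

    Σl-++ : (f : A → ℕ) (xs ys : List A) → Σl f (xs ++ ys) ≡ Σl f xs + Σl f ys
    Σl-++ f [] ys = refl
    Σl-++ f (x ∷ xs) ys = trans (cong (f x +_) (Σl-++ f xs ys)) (sym (ℕP.+-assoc (f x) _ _))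

    Σl-+ : (f g : A → ℕ) (xs : List A) → Σl (λ x → f x + g x) xs ≡ Σl f xs + Σl g xs
    Σl-+ f g [] = refl
    Σl-+ f g (x ∷ xs) rewrite Σl-+ f g xs = shuffle (f x) (g x) (Σl f xs) (Σl g xs)
      where
      shuffle : ∀ a b c d → a + b + (c + d) ≡ a + c + (b + d)
      shuffle = solve-∀

    Σl-* : (c : ℕ) (f : A → ℕ) (xs : List A) → Σl (λ x → c * f x) xs ≡ c * Σl f xs
    Σl-* c f [] = sym (ℕP.*-zeroʳ c)
    Σl-* c f (x ∷ xs) =
      trans (cong (c * f x +_) (Σl-* c f xs)) (sym (ℕP.*-distribˡ-+ c (f x) (Σl f xs)))

    Σl-zero : (xs : List A) → Σl (λ _ → 0) xs ≡ 0
    Σl-zero [] = refl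
    Σl-zero (x ∷ xs) = Σl-zero xs

    Σl-zero-scaled : (c : ℕ) (xs : List A) → c * Σl (λ _ → 0) xs ≡ 0
    Σl-zero-scaled c xs = trans (cong (c *_) (Σl-zero xs)) (ℕP.*-zeroʳ c)

  sumTo : ℕ → (ℕ → ℕ) → ℕ
  sumTo zero g = 0
  sumTo (suc n) g = g 0 + sumTo n (g ∘ suc)

  sumTo-split : ∀ a b g → sumTo (a + b) g ≡ sumTo a g + sumTo b (λ q → g (a + q))
  sumTo-split zero b g = refl
  sumTo-split (suc a) b g =
    trans (cong (g 0 +_) (sumTo-split a b (g ∘ suc))) (sym (ℕP.+-assoc (g 0) _ _))

  sumTo-const : ∀ n g c → (∀ q → q < n → g q ≡ c) → sumTo n g ≡ n * c
  sumTo-const zero g c _ = refl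
  sumTo-const (suc n) g c h =
    cong₂ _+_ (h 0 (s≤s z≤n)) (sumTo-const n (g ∘ suc) c (λ q q<n → h (suc q) (s≤s q<n)))

  sumTo-blocks : ∀ a k r g u v t →
    (∀ q → q < a → g q ≡ u) → (∀ q → a ≤ q → q < a + k → g q ≡ v) →
    (∀ q → a + k ≤ q → q < a + k + r → g q ≡ t) →
    sumTo (a + k + r) g ≡ a * u + k * v + r * t
  sumTo-blocks a k r g u v t on-u on-v on-t = begin
      sumTo (a + k + r) g
    ≡⟨ sumTo-split (a + k) r g ⟩
      sumTo (a + k) g + sumTo r (λ q → g (a + k + q))
    ≡⟨ cong (_+ sumTo r (λ q → g (a + k + q))) (sumTo-split a k g) ⟩
      sumTo a g + sumTo k (λ q → g (a + q)) + sumTo r (λ q → g (a + k + q))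
    ≡⟨ cong₂ _+_ (cong₂ _+_ (sumTo-const a g u on-u) (sumTo-const k _ v in-second))
                 (sumTo-const r _ t in-third) ⟩
      a * u + k * v + r * t
    ∎
    where
    open ≡-Reasoning
    in-second : ∀ q → q < k → g (a + q) ≡ v
    in-second q q<k = on-v (a + q) (ℕP.m≤m+n a q) (ℕP.+-monoʳ-< a q<k)
    in-third : ∀ q → q < r → g (a + k + q) ≡ t
    in-third q q<r = on-t (a + k + q) (ℕP.m≤m+n (a + k) q) (ℕP.+-monoʳ-< (a + k) q<r)

  sumTo-segments : ∀ a b n g u v t → a ≤ b → b ≤ n →
    (∀ q → q < a → g q ≡ u) → (∀ q → a ≤ q → q < b → g q ≡ v) → (∀ q → b ≤ q → q < n → g q ≡ t) →
    sumTo n g ≡ a * u + (b ∸ a) * v + (n ∸ b) * t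
  sumTo-segments a b n g u v t a≤b b≤n on-u on-v on-t =
    trans (cong (λ k → sumTo k g) (sym n≡)) (sumTo-blocks a (b ∸ a) (n ∸ b) g u v t on-u on-v′ on-t′)
    where
    b≡ : a + (b ∸ a) ≡ b
    b≡ = ℕP.m+[n∸m]≡n a≤b
    n≡ : a + (b ∸ a) + (n ∸ b) ≡ n
    n≡ = trans (cong (_+ (n ∸ b)) b≡) (ℕP.m+[n∸m]≡n b≤n)
    on-v′ : ∀ q → a ≤ q → q < a + (b ∸ a) → g q ≡ v
    on-v′ q a≤q q< = on-v q a≤q (subst (q <_) b≡ q<)
    on-t′ : ∀ q → a + (b ∸ a) ≤ q → q < a + (b ∸ a) + (n ∸ b) → g q ≡ t
    on-t′ q ≤q q< = on-t q (subst (_≤ q) b≡ ≤q) (subst (q <_) n≡ q<)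

  module _ {A : Set} where

    perms-↭ : (l : List A) → All (_↭ l) (perms l)
    perms-↭ [] = ↭-refl ∷ []
    perms-↭ (x ∷ l) = AllP.concat⁺ (AllP.map⁺ (All.map extend (perms-↭ l)))
      where
      insertions-↭ : (w : List A) → All (_↭ x ∷ w) (insertions x w)
      insertions-↭ [] = ↭-refl ∷ []
      insertions-↭ (y ∷ w) =
        ↭-refl ∷ AllP.map⁺ (All.map (λ v↭ → ↭-trans (prep y v↭) (swap y x ↭-refl)) (insertions-↭ w))
      extend : ∀ {w} → w ↭ l → All (_↭ x ∷ l) (insertions x w)
      extend w↭l = All.map (λ v↭ → ↭-trans v↭ (prep x w↭l)) (insertions-↭ _)

    Σl-insertions : (f : List A → ℕ) (x : A) (w : List A) →
                    Σl f (insertions x w) ≡ sumTo (suc (length w)) (λ q → f (ins q x w))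
    Σl-insertions f x [] = refl
    Σl-insertions f x (y ∷ w) =
      cong (f (x ∷ y ∷ w) +_) (trans (Σl-map (insertions x w)) (Σl-insertions (f ∘ (y ∷_)) x w))
      where
      Σl-map : (vs : List (List A)) → Σl f (map (y ∷_) vs) ≡ Σl (f ∘ (y ∷_)) vs
      Σl-map [] = refl
      Σl-map (v ∷ vs) = cong (f (y ∷ v) +_) (Σl-map vs)

    Σl-perms : (f : List A → ℕ) (x : A) (l : List A) →
      Σl f (perms (x ∷ l)) ≡ Σl (λ w → sumTo (suc (length w)) (λ q → f (ins q x w))) (perms l)
    Σl-perms f x l = trans (Σl-concat (perms l)) (Σl-cong (All.universal (Σl-insertions f x) (perms l)))
      where
      Σl-concat : (ws : List (List A)) →
        Σl f (concatMap (insertions x) ws) ≡ Σl (λ w → Σl f (insertions x w)) ws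
      Σl-concat [] = refl
      Σl-concat (w ∷ ws) =
        trans (Σl-++ f (insertions x w) _) (cong (Σl f (insertions x w) +_) (Σl-concat ws))

    Σ-perms-blocks : (f : List A → ℕ) (x : A) (l : List A) (u v t : List A → ℕ) (a b : ℕ) →
      a ≤ b → b ≤ suc (length l) →
      (∀ {w} → w ↭ l → ∀ q → q < a → f (ins q x w) ≡ u w) →
      (∀ {w} → w ↭ l → ∀ q → a ≤ q → q < b → f (ins q x w) ≡ v w) →
      (∀ {w} → w ↭ l → ∀ q → b ≤ q → q ≤ length w → f (ins q x w) ≡ t w) →
      Σl f (perms (x ∷ l))
        ≡ a * Σl u (perms l) + (b ∸ a) * Σl v (perms l) + (suc (length l) ∸ b) * Σl t (perms l)
    Σ-perms-blocks f x l u v t a b a≤b b≤n on-u on-v on-t = begin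
        Σl f (perms (x ∷ l))
      ≡⟨ Σl-perms f x l ⟩
        Σl (λ w → sumTo (suc (length w)) (λ q → f (ins q x w))) (perms l)
      ≡⟨ Σl-cong (All.map per-ordering (perms-↭ l)) ⟩
        Σl (λ w → a * u w + (b ∸ a) * v w + (n ∸ b) * t w) (perms l)
      ≡⟨ Σl-+ _ _ (perms l) ⟩
        Σl (λ w → a * u w + (b ∸ a) * v w) (perms l) + Σl (λ w → (n ∸ b) * t w) (perms l)
      ≡⟨ cong₂ _+_ (trans (Σl-+ _ _ (perms l)) (cong₂ _+_ (Σl-* a u (perms l)) (Σl-* (b ∸ a) v (perms l))))
                   (Σl-* (n ∸ b) t (perms l)) ⟩
        a * Σl u (perms l) + (b ∸ a) * Σl v (perms l) + (n ∸ b) * Σl t (perms l)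
      ∎
      where
      open ≡-Reasoning
      n = suc (length l)
      per-ordering : ∀ {w} → w ↭ l →
        sumTo (suc (length w)) (λ q → f (ins q x w)) ≡ a * u w + (b ∸ a) * v w + (n ∸ b) * t w
      per-ordering {w} w↭l rewrite sym (↭-length w↭l) =
        sumTo-segments a b (suc (length w)) _ (u w) (v w) (t w) a≤b b≤n
          (on-u w↭l) (on-v w↭l) (λ q b≤q q<n → on-t w↭l q b≤q (ℕP.≤-pred q<n))

  countPrefix : List (Fin N) → ℕ → Subset N → ℕ
  countPrefix l L U = Σl (λ w → ind (prefix L w ≟ˢ U)) (perms l)

  countPrefixWith : List (Fin N) → ℕ → Subset N → Fin N → ℕ → ℕ
  countPrefixWith l L U z a = Σl (λ w → ind ((prefix L w ≟ˢ U) ∧ memb z (prefix a w))) (perms l)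

  countPrefixWith-0 : (l : List (Fin N)) (L : ℕ) (U : Subset N) (z : Fin N) →
                      countPrefixWith l L U z 0 ≡ 0
  countPrefixWith-0 l L U z = trans (Σl-cong (All.universal summand (perms l))) (Σl-zero (perms l))
    where
    summand : ∀ w → ind ((prefix L w ≟ˢ U) ∧ memb z (prefix 0 w)) ≡ 0
    summand w rewrite memb-prefix-0 z w = cong ind (BoolP.∧-zeroʳ _)

  countPrefix-0 : (l : List (Fin N)) (U : Subset N) (z : Fin N) → z ∈ U → countPrefix l 0 U ≡ 0
  countPrefix-0 l U z z∈U = trans (Σl-cong (All.universal summand (perms l))) (Σl-zero (perms l))
    where
    summand : ∀ w → ind (prefix 0 w ≟ˢ U) ≡ 0
    summand w = cong ind (≟ˢ-false (λ ∅≡U → ∉⊥ (subst (z ∈_) (sym ∅≡U) z∈U)))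

  -- When z ∈ U, every ordering whose first L entries form U has z among them.
  countPrefixWith-all : (l : List (Fin N)) (L : ℕ) (U : Subset N) (z : Fin N) → z ∈ U →
                        countPrefixWith l L U z L ≡ countPrefix l L U
  countPrefixWith-all l L U z z∈U = Σl-cong (All.universal summand (perms l))
    where
    summand : ∀ w → ind ((prefix L w ≟ˢ U) ∧ memb z (prefix L w)) ≡ ind (prefix L w ≟ˢ U)
    summand w with prefix L w ≟ˢ U in eq
    ... | true = cong ind (memb-in (subst (z ∈_) (sym (≟ˢ-sound eq)) z∈U))
    ... | false = refl

  module InsertionStep {x : Fin N} {l : List (Fin N)} (x∉l : x ∉ˡ l) {U : Subset N} where

    private
      fresh : ∀ {w} → w ↭ l → x ∉ˡ w
      fresh w↭l x∈w = x∉l (∈-resp-↭ w↭l x∈w)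

      shorter : ∀ {w k} → w ↭ l → k ≤ length l → k ≤ length w
      shorter w↭l = subst (_ ≤_) (↭-length (↭-sym w↭l))

      early-in-U : ∀ {w} → w ↭ l → x ∈ U → ∀ q L → q ≤ L →
                   (prefix (suc L) (ins q x w) ≟ˢ U) ≡ (prefix L w ≟ˢ (U - x))
      early-in-U {w} w↭l x∈U q L q≤L rewrite prefix-ins-early q L x w q≤L =
        ≟ˢ-cong (⁅⁆∪≡⇔≡remove (prefix-fresh L w (fresh w↭l)) x∈U)

      early-not-in-U : ∀ w → x ∉ U → ∀ q L → q ≤ L → (prefix (suc L) (ins q x w) ≟ˢ U) ≡ false
      early-not-in-U w x∉U q L q≤L rewrite prefix-ins-early q L x w q≤L =
        ≟ˢ-false (λ e → x∉U (subst (x ∈_) e (∈-⁅⁆∪-here x _)))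

      -- Inserting x ∈ U late: the prefix misses x, so it is not U.
      late-in-U : ∀ {w} → w ↭ l → x ∈ U → ∀ q L → L ≤ q → q ≤ length w →
                  (prefix L (ins q x w) ≟ˢ U) ≡ false
      late-in-U {w} w↭l x∈U q L L≤q q≤ rewrite prefix-ins-late q L x w L≤q q≤ =
        ≟ˢ-false (λ e → prefix-fresh L w (fresh w↭l) (subst (x ∈_) (sym e) x∈U))

      memb-early : ∀ z w q a → q ≤ a →
                   memb z (prefix (suc a) (ins q x w)) ≡ memb z (⁅ x ⁆ ∪ prefix a w)
      memb-early z w q a q≤a = cong (memb z) (prefix-ins-early q a x w q≤a)

      memb-late : ∀ z w q a → a ≤ q → q ≤ length w → memb z (prefix a (ins q x w)) ≡ memb z (prefix a w)
      memb-late z w q a a≤q q≤ = cong (memb z) (prefix-ins-late q a x w a≤q q≤)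

    -- x ∉ U: only the insertions at positions ≥ L keep the prefix equal to U,
    -- and they do not move the window of z.
    count-absent : (z : Fin N) (L0 a : ℕ) → x ∉ U → a ≤ suc L0 → L0 ≤ length l →
      countPrefixWith (x ∷ l) (suc L0) U z a ≡ (length l ∸ L0) * countPrefixWith l (suc L0) U z a
    count-absent z L0 a x∉U a≤L L0≤ = begin
        countPrefixWith (x ∷ l) (suc L0) U z a
      ≡⟨ Σ-perms-blocks hit x l (λ _ → 0) (λ _ → 0) hit 0 (suc L0) z≤n (s≤s L0≤) (λ _ q ()) on-v on-t ⟩
        suc L0 * Σl (λ _ → 0) (perms l) + (length l ∸ L0) * countPrefixWith l (suc L0) U z a
      ≡⟨ cong (_+ (length l ∸ L0) * countPrefixWith l (suc L0) U z a) (Σl-zero-scaled (suc L0) (perms l)) ⟩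
        (length l ∸ L0) * countPrefixWith l (suc L0) U z a
      ∎
      where
      open ≡-Reasoning
      hit : List (Fin N) → ℕ
      hit w = ind ((prefix (suc L0) w ≟ˢ U) ∧ memb z (prefix a w))
      on-v : ∀ {w} → w ↭ l → ∀ q → 0 ≤ q → q < suc L0 → hit (ins q x w) ≡ 0
      on-v {w} _ q _ (s≤s q≤L0) rewrite early-not-in-U w x∉U q L0 q≤L0 = refl
      on-t : ∀ {w} → w ↭ l → ∀ q → suc L0 ≤ q → q ≤ length w → hit (ins q x w) ≡ hit w
      on-t {w} _ q L≤q q≤
        rewrite prefix-ins-late q (suc L0) x w L≤q q≤ | memb-late z w q a (ℕP.≤-trans a≤L L≤q) q≤ = refl

    -- z = x ∈ U: x lies in the window of length a0 + 1 exactly for the first a0 + 1 positions.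
    count-self : (L0 a0 : ℕ) → x ∈ U → a0 ≤ L0 → L0 ≤ length l →
      countPrefixWith (x ∷ l) (suc L0) U x (suc a0) ≡ suc a0 * countPrefix l L0 (U - x)
    count-self L0 a0 x∈U a0≤L0 L0≤ = begin
        countPrefixWith (x ∷ l) (suc L0) U x (suc a0)
      ≡⟨ Σ-perms-blocks hit x l old (λ _ → 0) (λ _ → 0) (suc a0) (suc L0) (s≤s a0≤L0) (s≤s L0≤)
                        on-u on-v on-t ⟩
        B + (L0 ∸ a0) * Σl (λ _ → 0) (perms l) + (length l ∸ L0) * Σl (λ _ → 0) (perms l)
      ≡⟨ cong₂ (λ p r → B + p + r) (Σl-zero-scaled (L0 ∸ a0) (perms l))
                                   (Σl-zero-scaled (length l ∸ L0) (perms l)) ⟩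
        B + 0 + 0
      ≡⟨ trans (ℕP.+-identityʳ _) (ℕP.+-identityʳ _) ⟩
        B
      ∎
      where
      open ≡-Reasoning
      B = suc a0 * countPrefix l L0 (U - x)
      hit : List (Fin N) → ℕ
      hit w = ind ((prefix (suc L0) w ≟ˢ U) ∧ memb x (prefix (suc a0) w))
      old : List (Fin N) → ℕ
      old w = ind (prefix L0 w ≟ˢ (U - x))
      on-u : ∀ {w} → w ↭ l → ∀ q → q < suc a0 → hit (ins q x w) ≡ old w
      on-u {w} w↭l q (s≤s q≤a0)
        rewrite early-in-U w↭l x∈U q L0 (ℕP.≤-trans q≤a0 a0≤L0) | memb-early x w q a0 q≤a0
              | memb-in (∈-⁅⁆∪-here x (prefix a0 w)) = cong ind (BoolP.∧-identityʳ _)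
      on-v : ∀ {w} → w ↭ l → ∀ q → suc a0 ≤ q → q < suc L0 → hit (ins q x w) ≡ 0
      on-v {w} w↭l q a<q (s≤s q≤L0)
        rewrite memb-late x w q (suc a0) a<q (ℕP.≤-trans q≤L0 (shorter w↭l L0≤))
              | memb-out (prefix-fresh (suc a0) w (fresh w↭l)) = cong ind (BoolP.∧-zeroʳ _)
      on-t : ∀ {w} → w ↭ l → ∀ q → suc L0 ≤ q → q ≤ length w → hit (ins q x w) ≡ 0
      on-t w↭l q L≤q q≤ rewrite late-in-U w↭l x∈U q (suc L0) L≤q q≤ = refl

    -- z ≠ x ∈ U: inserting x at a position ≤ a0 shifts z out of the last slot
    -- of its window, inserting it later keeps the window; late insertions
    -- do not count.
    count-other : (z : Fin N) (L0 a0 : ℕ) → ¬ z ≡ x → x ∈ U → a0 ≤ L0 → L0 ≤ length l →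
      countPrefixWith (x ∷ l) (suc L0) U z (suc a0)
        ≡ suc a0 * countPrefixWith l L0 (U - x) z a0 + (L0 ∸ a0) * countPrefixWith l L0 (U - x) z (suc a0)
    count-other z L0 a0 z≢x x∈U a0≤L0 L0≤ = begin
        countPrefixWith (x ∷ l) (suc L0) U z (suc a0)
      ≡⟨ Σ-perms-blocks hit x l (old a0) (old (suc a0)) (λ _ → 0) (suc a0) (suc L0) (s≤s a0≤L0) (s≤s L0≤)
                        on-u on-v on-t ⟩
        A + (length l ∸ L0) * Σl (λ _ → 0) (perms l)
      ≡⟨ trans (cong (A +_) (Σl-zero-scaled (length l ∸ L0) (perms l))) (ℕP.+-identityʳ _) ⟩
        A
      ∎
      where
      open ≡-Reasoning
      A = suc a0 * countPrefixWith l L0 (U - x) z a0 + (L0 ∸ a0) * countPrefixWith l L0 (U - x) z (suc a0)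
      hit : List (Fin N) → ℕ
      hit w = ind ((prefix (suc L0) w ≟ˢ U) ∧ memb z (prefix (suc a0) w))
      old : ℕ → List (Fin N) → ℕ
      old a w = ind ((prefix L0 w ≟ˢ (U - x)) ∧ memb z (prefix a w))
      on-u : ∀ {w} → w ↭ l → ∀ q → q < suc a0 → hit (ins q x w) ≡ old a0 w
      on-u {w} w↭l q (s≤s q≤a0)
        rewrite early-in-U w↭l x∈U q L0 (ℕP.≤-trans q≤a0 a0≤L0) | memb-early z w q a0 q≤a0
              | memb-⁅⁆∪-other (prefix a0 w) z≢x = refl
      on-v : ∀ {w} → w ↭ l → ∀ q → suc a0 ≤ q → q < suc L0 → hit (ins q x w) ≡ old (suc a0) w
      on-v {w} w↭l q a<q (s≤s q≤L0)
        rewrite early-in-U w↭l x∈U q L0 q≤L0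
              | memb-late z w q (suc a0) a<q (ℕP.≤-trans q≤L0 (shorter w↭l L0≤)) = refl
      on-t : ∀ {w} → w ↭ l → ∀ q → suc L0 ≤ q → q ≤ length w → hit (ins q x w) ≡ 0
      on-t w↭l q L≤q q≤ rewrite late-in-U w↭l x∈U q (suc L0) L≤q q≤ = refl

    -- The plain count is the special case of a window covering the whole prefix.
    countPrefix-absent : (z : Fin N) (L0 : ℕ) → z ∈ U → x ∉ U → L0 ≤ length l →
      countPrefix (x ∷ l) (suc L0) U ≡ (length l ∸ L0) * countPrefix l (suc L0) U
    countPrefix-absent z L0 z∈U x∉U L0≤ = begin
        countPrefix (x ∷ l) (suc L0) U
      ≡⟨ sym (countPrefixWith-all (x ∷ l) (suc L0) U z z∈U) ⟩
        countPrefixWith (x ∷ l) (suc L0) U z (suc L0)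
      ≡⟨ count-absent z L0 (suc L0) x∉U ℕP.≤-refl L0≤ ⟩
        (length l ∸ L0) * countPrefixWith l (suc L0) U z (suc L0)
      ≡⟨ cong ((length l ∸ L0) *_) (countPrefixWith-all l (suc L0) U z z∈U) ⟩
        (length l ∸ L0) * countPrefix l (suc L0) U
      ∎
      where open ≡-Reasoning

    countPrefix-present : (L0 : ℕ) → x ∈ U → L0 ≤ length l →
      countPrefix (x ∷ l) (suc L0) U ≡ suc L0 * countPrefix l L0 (U - x)
    countPrefix-present L0 x∈U L0≤ =
      trans (sym (countPrefixWith-all (x ∷ l) (suc L0) U x x∈U)) (count-self L0 L0 x∈U ℕP.≤-refl L0≤)

  ∸-positive : {a b : ℕ} → 0 < b ∸ a → a < b
  ∸-positive pos = ℕP.m∸n≢0⇒n<m (ℕP.>⇒≢ pos)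

  *-congˡ-positive : ∀ d {p q : ℕ} → (0 < d → p ≡ q) → d * p ≡ d * q
  *-congˡ-positive zero _ = refl
  *-congˡ-positive (suc d) p≡q = cong (suc d *_) (p≡q (s≤s z≤n))

  -- The arithmetic of the inductive step when z is not the inserted element:
  -- the identities for the windows a0 and a0 + 1 over l (the latter needed
  -- only when a0 < L) give the identity for the window a0 + 1 over x ∷ l.
  uniform-step : ∀ L a0 A0 A1 B0 → a0 ≤ L → (L ≡ 0 → A0 ≡ B0) →
    L * A0 ≡ a0 * B0 → (a0 < L → L * A1 ≡ suc a0 * B0) →
    suc L * (suc a0 * A0 + (L ∸ a0) * A1) ≡ suc a0 * (suc L * B0)
  uniform-step zero .zero A0 A1 B0 z≤n degenerate _ _ rewrite degenerate refl = ℕP.+-identityʳ _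
  uniform-step L@(suc _) a0 A0 A1 B0 a0≤L _ IH-a0 IH-suc-a0 = ℕP.*-cancelˡ-≡ _ _ L (begin
      L * (suc L * (suc a0 * A0 + d * A1))
    ≡⟨ regroup L a0 d A0 A1 ⟩
      suc L * (suc a0 * (L * A0) + d * (L * A1))
    ≡⟨ cong₂ (λ p r → suc L * (suc a0 * p + r)) IH-a0 (*-congˡ-positive d (IH-suc-a0 ∘ ∸-positive)) ⟩
      suc L * (suc a0 * (a0 * B0) + d * (suc a0 * B0))
    ≡⟨ collect L a0 d B0 ⟩
      (a0 + d) * (suc a0 * (suc L * B0))
    ≡⟨ cong (_* (suc a0 * (suc L * B0))) (ℕP.m+[n∸m]≡n a0≤L) ⟩
      L * (suc a0 * (suc L * B0))
    ∎)
    where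
    open ≡-Reasoning
    d = L ∸ a0
    regroup : ∀ L a0 d A0 A1 →
      L * (suc L * (suc a0 * A0 + d * A1)) ≡ suc L * (suc a0 * (L * A0) + d * (L * A1))
    regroup = solve-∀
    collect : ∀ L a0 d B0 →
      suc L * (suc a0 * (a0 * B0) + d * (suc a0 * B0)) ≡ (a0 + d) * (suc a0 * (suc L * B0))
    collect = solve-∀

  position-uniform : (l : List (Fin N)) → Unique l → (L : ℕ) (U : Subset N) (z : Fin N) (a : ℕ) →
    L ≤ length l → z ∈ U → a ≤ L → L * countPrefixWith l L U z a ≡ a * countPrefix l L U
  position-uniform l _ L U z zero _ _ _ = trans (cong (L *_) (countPrefixWith-0 l L U z)) (ℕP.*-zeroʳ L)
  position-uniform (x ∷ l) u@(_ ∷ ul) (suc L0) U z (suc a0) (s≤s L0≤) z∈U (s≤s a0≤L0) with x ∈? U | x ≟ z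
  ... | no x∉U | _ = begin
      suc L0 * countPrefixWith (x ∷ l) (suc L0) U z (suc a0)
    ≡⟨ cong (suc L0 *_) (count-absent z L0 (suc a0) x∉U (s≤s a0≤L0) L0≤) ⟩
      suc L0 * (c * countPrefixWith l (suc L0) U z (suc a0))
    ≡⟨ *-left-comm (suc L0) c _ ⟩
      c * (suc L0 * countPrefixWith l (suc L0) U z (suc a0))
    ≡⟨ *-congˡ-positive c (λ pos → IH (∸-positive pos)) ⟩
      c * (suc a0 * countPrefix l (suc L0) U)
    ≡⟨ *-left-comm c (suc a0) _ ⟩
      suc a0 * (c * countPrefix l (suc L0) U)
    ≡⟨ cong (suc a0 *_) (sym (countPrefix-absent z L0 z∈U x∉U L0≤)) ⟩
      suc a0 * countPrefix (x ∷ l) (suc L0) U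
    ∎
    where
    open ≡-Reasoning
    open InsertionStep (Unique[x∷xs]⇒x∉xs u) {U}
    c = length l ∸ L0
    IH : L0 < length l → suc L0 * countPrefixWith l (suc L0) U z (suc a0) ≡ suc a0 * countPrefix l (suc L0) U
    IH L0<∣l∣ = position-uniform l ul (suc L0) U z (suc a0) L0<∣l∣ z∈U (s≤s a0≤L0)
  ... | yes x∈U | yes refl = begin
      suc L0 * countPrefixWith (x ∷ l) (suc L0) U x (suc a0)
    ≡⟨ cong (suc L0 *_) (count-self L0 a0 x∈U a0≤L0 L0≤) ⟩
      suc L0 * (suc a0 * countPrefix l L0 (U - x))
    ≡⟨ *-left-comm (suc L0) (suc a0) _ ⟩
      suc a0 * (suc L0 * countPrefix l L0 (U - x))
    ≡⟨ cong (suc a0 *_) (sym (countPrefix-present L0 x∈U L0≤)) ⟩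
      suc a0 * countPrefix (x ∷ l) (suc L0) U
    ∎
    where
    open ≡-Reasoning
    open InsertionStep (Unique[x∷xs]⇒x∉xs u) {U}
  ... | yes x∈U | no x≢z = begin
      suc L0 * countPrefixWith (x ∷ l) (suc L0) U z (suc a0)
    ≡⟨ cong (suc L0 *_) (count-other z L0 a0 (x≢z ∘ sym) x∈U a0≤L0 L0≤) ⟩
      suc L0 * (suc a0 * A0 + (L0 ∸ a0) * A1)
    ≡⟨ uniform-step L0 a0 A0 A1 B0 a0≤L0 degenerate (IH a0 a0≤L0) (IH (suc a0)) ⟩
      suc a0 * (suc L0 * B0)
    ≡⟨ cong (suc a0 *_) (sym (countPrefix-present L0 x∈U L0≤)) ⟩
      suc a0 * countPrefix (x ∷ l) (suc L0) U
    ∎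
    where
    open ≡-Reasoning
    open InsertionStep (Unique[x∷xs]⇒x∉xs u) {U}
    A0 = countPrefixWith l L0 (U - x) z a0
    A1 = countPrefixWith l L0 (U - x) z (suc a0)
    B0 = countPrefix l L0 (U - x)
    z∈U-x : z ∈ U - x
    z∈U-x = x∈p∧x≢y⇒x∈p-y z∈U (x≢z ∘ sym)
    IH : ∀ a → a ≤ L0 → L0 * countPrefixWith l L0 (U - x) z a ≡ a * B0
    IH a a≤L0 = position-uniform l ul L0 (U - x) z a L0≤ z∈U-x a≤L0
    -- With an empty prefix both counts vanish.
    degenerate : L0 ≡ 0 → A0 ≡ B0
    degenerate L0≡0 =
      trans (subst (λ a → countPrefixWith l L0 (U - x) z a ≡ 0) (sym a0≡0) (countPrefixWith-0 l L0 (U - x) z))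
            (sym (subst (λ L → countPrefix l L (U - x) ≡ 0) (sym L0≡0) (countPrefix-0 l (U - x) z z∈U-x)))
      where
      a0≡0 : a0 ≡ 0
      a0≡0 = ℕP.n≤0⇒n≡0 (subst (a0 ≤_) L0≡0 a0≤L0)

_IsMaxOf_ : Fin N → List (Fin N) → Set
z IsMaxOf xs = z ∈ˡ xs × (∀ {y} → y ∈ˡ xs → toℕ y ≤ toℕ z)

isMax-⁅⁆∪⁻ : {c y : Fin N} (S : Subset N) → isMax c (⁅ c ⁆ ∪ S) ≡ true → y ∈ S → toℕ y ≤ toℕ c
isMax-⁅⁆∪⁻ {c = c} S c-max y∈S = ≤ᵇ-sound (allIn-sound (⁅ c ⁆ ∪ S) _ c-max (∈-⁅⁆∪-there c y∈S))

isMax-⁅⁆∪⁺ : {c : Fin N} (S : Subset N) → (∀ {y} → y ∈ S → toℕ y ≤ toℕ c) → isMax c (⁅ c ⁆ ∪ S) ≡ true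
isMax-⁅⁆∪⁺ {c = c} S bound = allIn-complete (⁅ c ⁆ ∪ S) _ bounded
  where
  bounded : ∀ {y} → y ∈ ⁅ c ⁆ ∪ S → (toℕ y ≤ᵇ toℕ c) ≡ true
  bounded p with ∈-⁅⁆∪⁻ S p
  ... | inj₁ refl = ≤ᵇ-true (ℕP.≤-refl {toℕ c})
  ... | inj₂ y∈S = ≤ᵇ-true (bound y∈S)

∉-before : {A : Set} (pre : List A) {c : A} {cs : List A} → Unique (pre ++ c ∷ cs) → c ∉ˡ pre
∉-before (p ∷ pre) (p∉ ∷ _) (here refl) = All.lookup p∉ (∈-++⁺ʳ pre (here refl)) refl
∉-before (p ∷ pre) (_ ∷ u) (there c∈pre) = ∉-before pre u c∈pre

max-arrival-fresh : {z c : Fin N} (pre : List (Fin N)) {cs rest : List (Fin N)} →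
  Unique (pre ++ c ∷ cs) → z IsMaxOf (pre ++ c ∷ rest) → isMax c (⁅ c ⁆ ∪ setOf pre) ≡ true →
  z ∉ setOf pre
max-arrival-fresh {z = z} {c} pre u (_ , z-max) c-max z∈pre =
  ∉-before pre u (subst (_∈ˡ pre) z≡c (setOf⁻ pre z∈pre))
  where
  z≡c : z ≡ c
  z≡c = toℕ-injective (ℕP.≤-antisym (isMax-⁅⁆∪⁻ (setOf pre) c-max z∈pre) (z-max (∈-++⁺ʳ pre (here refl))))

non-max-arrival : {z c : Fin N} (pre : List (Fin N)) {rest : List (Fin N)} →
  z IsMaxOf (pre ++ c ∷ rest) → isMax c (⁅ c ⁆ ∪ setOf pre) ≡ false → ¬ z ≡ c
non-max-arrival pre (_ , z-max) c-not-max refl =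
  contradiction (trans (sym c-not-max) (isMax-⁅⁆∪⁺ (setOf pre) (z-max ∘ ∈-++⁺ˡ ∘ setOf⁻ pre))) (λ ())

within-budget : {n r : ℕ} (pre : List (Fin N)) (c : Fin N) → length pre + suc r ≤ n →
                ∣ ⁅ c ⁆ ∪ setOf pre ∣ ≤ n
within-budget {n = n} {r = r} pre c len =
  ℕP.≤-trans (∣⁅⁆∪∣≤ c (setOf pre))
    (ℕP.≤-trans (s≤s (ℕP.≤-trans (∣setOf∣≤length pre) (ℕP.m≤m+n (length pre) r)))
      (subst (_≤ n) (ℕP.+-suc (length pre) r) len))

module Survival (n m : ℕ) where

  rejectProb-early : {k : ℕ} (T : Subset N) (c : Fin N) → k ≤ m → rejectProb n m T c k ≡ 1ℚ
  rejectProb-early T c k≤m rewrite ≤ᵇ-true k≤m = refl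

  rejectProb-late : {k : ℕ} (T : Subset N) (c : Fin N) → m < k → ∣ ⁅ c ⁆ ∪ T ∣ ≤ n →
    rejectProb n m T c k ≡ (if isMax c (⁅ c ⁆ ∪ T) then 0ℚ else 1ℚ)
  rejectProb-late T c m<k small rewrite ≤ᵇ-false m<k | ≤ᵇ-true small = refl

  survive-none : {k : ℕ} (T : Subset N) (cs : List (Fin N)) → survive n m k T cs 0 ≡ 1ℚ
  survive-none T [] = refl
  survive-none T (c ∷ cs) = refl

  survive-early : ∀ d k (pre cs : List (Fin N)) r → k + d ≤ suc m →
    survive n m k (setOf pre) cs (d + r) ≡ survive n m (d + k) (setOf (pre ++ take d cs)) (drop d cs) r
  survive-early zero k pre cs r _ rewrite ListP.++-identityʳ pre = refl
  survive-early (suc d) k pre [] r _ = refl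
  survive-early (suc d) k pre (c ∷ cs) r k+d<m+1 = begin
      rejectProb n m (setOf pre) c k ℚ.* survive n m (suc k) (⁅ c ⁆ ∪ setOf pre) cs (d + r)
    ≡⟨ cong (ℚ._* survive n m (suc k) (⁅ c ⁆ ∪ setOf pre) cs (d + r)) (rejectProb-early (setOf pre) c k≤m) ⟩
      1ℚ ℚ.* survive n m (suc k) (⁅ c ⁆ ∪ setOf pre) cs (d + r)
    ≡⟨ ℚP.*-identityˡ _ ⟩
      survive n m (suc k) (⁅ c ⁆ ∪ setOf pre) cs (d + r)
    ≡⟨ cong (λ T → survive n m (suc k) T cs (d + r)) (sym (setOf-snoc pre c)) ⟩
      survive n m (suc k) (setOf (pre ++ c ∷ [])) cs (d + r)
    ≡⟨ survive-early d (suc k) (pre ++ c ∷ []) cs r (subst (_≤ suc m) (ℕP.+-suc k d) k+d<m+1) ⟩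
      survive n m (d + suc k) (setOf ((pre ++ c ∷ []) ++ take d cs)) (drop d cs) r
    ≡⟨ cong₂ (λ i v → survive n m i (setOf v) (drop d cs) r)
             (ℕP.+-suc d k) (ListP.++-assoc pre (c ∷ []) (take d cs)) ⟩
      survive n m (suc d + k) (setOf (pre ++ c ∷ take d cs)) (drop d cs) r
    ∎
    where
    open ≡-Reasoning
    k≤m : k ≤ m
    k≤m = ℕP.≤-trans (ℕP.m≤m+n k d) (ℕP.≤-pred (subst (_≤ suc m) (ℕP.+-suc k d) k+d<m+1))

  survive-late : ∀ r k z (pre cs : List (Fin N)) → m < k → length pre + r ≤ n → Unique (pre ++ cs) →
    z IsMaxOf (pre ++ take r cs) → survive n m k (setOf pre) cs r ≡ (if memb z (setOf pre) then 1ℚ else 0ℚ)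
  survive-late zero k z pre cs _ _ _ (z∈ , _)
    rewrite memb-in (setOf⁺ pre (subst (z ∈ˡ_) (ListP.++-identityʳ pre) z∈)) = survive-none (setOf pre) cs
  survive-late (suc r) k z pre [] _ _ _ (z∈ , _)
    rewrite memb-in (setOf⁺ pre (subst (z ∈ˡ_) (ListP.++-identityʳ pre) z∈)) = refl
  survive-late (suc r) k z pre (c ∷ cs) m<k len u z-max
    rewrite rejectProb-late (setOf pre) c m<k (within-budget pre c len)
    with isMax c (⁅ c ⁆ ∪ setOf pre) in c-max
  ... | true = begin
      0ℚ ℚ.* survive n m (suc k) (⁅ c ⁆ ∪ setOf pre) cs r
    ≡⟨ ℚP.*-zeroˡ (survive n m (suc k) (⁅ c ⁆ ∪ setOf pre) cs r) ⟩
      0ℚ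
    ≡⟨ cong (if_then 1ℚ else 0ℚ) (sym (memb-out (max-arrival-fresh pre u z-max c-max))) ⟩
      (if memb z (setOf pre) then 1ℚ else 0ℚ)
    ∎
    where open ≡-Reasoning
  ... | false = begin
      1ℚ ℚ.* survive n m (suc k) (⁅ c ⁆ ∪ setOf pre) cs r
    ≡⟨ ℚP.*-identityˡ (survive n m (suc k) (⁅ c ⁆ ∪ setOf pre) cs r) ⟩
      survive n m (suc k) (⁅ c ⁆ ∪ setOf pre) cs r
    ≡⟨ cong (λ T → survive n m (suc k) T cs r) (sym (setOf-snoc pre c)) ⟩
      survive n m (suc k) (setOf pre′) cs r
    ≡⟨ survive-late r (suc k) z pre′ cs (ℕP.m≤n⇒m≤1+n m<k) len′ u′ z-max′ ⟩
      (if memb z (setOf pre′) then 1ℚ else 0ℚ)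
    ≡⟨ cong (if_then 1ℚ else 0ℚ) (trans (cong (memb z) (setOf-snoc pre c)) (memb-⁅⁆∪-other (setOf pre) z≢c)) ⟩
      (if memb z (setOf pre) then 1ℚ else 0ℚ)
    ∎
    where
    open ≡-Reasoning
    pre′ = pre ++ c ∷ []
    shift : ∀ ys → pre′ ++ ys ≡ pre ++ c ∷ ys
    shift ys = ListP.++-assoc pre (c ∷ []) ys
    len′ : length pre′ + r ≤ n
    len′ = subst (_≤ n) (sym (trans (cong (_+ r) (ListP.length-++ pre)) (ℕP.+-assoc (length pre) 1 r))) len
    u′ : Unique (pre′ ++ cs)
    u′ = subst Unique (sym (shift cs)) u
    z-max′ : z IsMaxOf (pre′ ++ take r cs)
    z-max′ = subst (z IsMaxOf_) (sym (shift (take r cs))) z-max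
    z≢c : ¬ z ≡ c
    z≢c = non-max-arrival pre z-max c-max

  survival-indicator : ∀ h ℓ (w : List (Fin N)) (z : Fin N) → Unique w → m < ℓ → h + ℓ ≤ n →
    h + ℓ ≤ length w → z IsMaxOf take (h + ℓ) w →
    survive n m 1 (setOf (take h w)) (drop h w) ℓ ≡ (if memb z (prefix (h + m) w) then 1ℚ else 0ℚ)
  survival-indicator h ℓ w z uw m<ℓ h+ℓ≤n h+ℓ≤∣w∣ z-max = begin
      survive n m 1 (setOf (take h w)) (drop h w) ℓ
    ≡⟨ cong (survive n m 1 (setOf (take h w)) (drop h w)) (sym m+r≡ℓ) ⟩
      survive n m 1 (setOf (take h w)) (drop h w) (m + r)
    ≡⟨ survive-early m 1 (take h w) (drop h w) r ℕP.≤-refl ⟩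
      survive n m (m + 1) (setOf (take h w ++ take m (drop h w))) (drop m (drop h w)) r
    ≡⟨ cong₂ (λ v cs → survive n m (m + 1) (setOf v) cs r) (sym (take-+ h m w)) (ListP.drop-drop h m w) ⟩
      survive n m (m + 1) (setOf seen) rest r
    ≡⟨ survive-late r (m + 1) z seen rest (ℕP.m<m+n m (s≤s z≤n)) budget unique max-seen ⟩
      (if memb z (setOf seen) then 1ℚ else 0ℚ)
    ∎
    where
    open ≡-Reasoning
    r = ℓ ∸ m
    m+r≡ℓ : m + r ≡ ℓ
    m+r≡ℓ = ℕP.m+[n∸m]≡n (ℕP.<⇒≤ m<ℓ)
    seen = take (h + m) w
    rest = drop (h + m) w
    h+m+r≡h+ℓ : h + m + r ≡ h + ℓ
    h+m+r≡h+ℓ = trans (ℕP.+-assoc h m r) (cong (h +_) m+r≡ℓ)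
    ∣seen∣ : length seen ≡ h + m
    ∣seen∣ = trans (ListP.length-take (h + m) w)
                   (ℕP.m≤n⇒m⊓n≡m (ℕP.≤-trans (ℕP.+-monoʳ-≤ h (ℕP.<⇒≤ m<ℓ)) h+ℓ≤∣w∣))
    budget : length seen + r ≤ n
    budget = subst (λ k → k + r ≤ n) (sym ∣seen∣) (subst (_≤ n) (sym h+m+r≡h+ℓ) h+ℓ≤n)
    unique : Unique (seen ++ rest)
    unique = subst Unique (sym (ListP.take++drop≡id (h + m) w)) uw
    max-seen : z IsMaxOf (seen ++ take r rest)
    max-seen = subst (z IsMaxOf_) (trans (cong (λ k → take k w) (sym h+m+r≡h+ℓ)) (take-+ (h + m) r w)) z-max

fromℕ≡mkℚ : ∀ a → fromℕ a ≡ mkℚ (ℤ.+ a) 0 (Coprime.sym (Coprime.1-coprimeTo a))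
fromℕ≡mkℚ a = ℚP.normalize-coprime (Coprime.sym (Coprime.1-coprimeTo a))

fromℕ-+ : ∀ a b → fromℕ (a + b) ≡ fromℕ a ℚ.+ fromℕ b
fromℕ-+ a b rewrite fromℕ≡mkℚ a | fromℕ≡mkℚ b =
  cong (ℚ._/ 1) (sym (cong₂ ℤ._+_ (ℤP.*-identityʳ (ℤ.+ a)) (ℤP.*-identityʳ (ℤ.+ b))))

fromℕ-* : ∀ a b → fromℕ (a ℕ.* b) ≡ fromℕ a ℚ.* fromℕ b
fromℕ-* a b rewrite fromℕ≡mkℚ a | fromℕ≡mkℚ b = cong (ℚ._/ 1) (ℤP.pos-* a b)

open Counting using (ind; Σl; perms-↭; countPrefix; countPrefixWith; position-uniform)

sumℚ-fromℕ : {A : Set} (F : A → ℚ) (f : A → ℕ) (xs : List A) →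
  All (λ x → F x ≡ fromℕ (f x)) xs → sumℚ (map F xs) ≡ fromℕ (Σl f xs)
sumℚ-fromℕ F f [] [] = refl
sumℚ-fromℕ F f (x ∷ xs) (e ∷ es) =
  trans (cong₂ ℚ._+_ e (sumℚ-fromℕ F f xs es)) (sym (fromℕ-+ (f x) (Σl f xs)))

length-filter : {A : Set} (p : A → Bool) (xs : List A) → length (filter p xs) ≡ Σl (ind ∘ p) xs
length-filter p [] = refl
length-filter p (x ∷ xs) with p x
... | true = cong suc (length-filter p xs)
... | false = length-filter p xs

surviving-mass : (n h m ℓ : ℕ) (U : Subset (n + h)) (z : Fin (n + h)) →
  z ∈ U → (∀ {y} → y ∈ U → toℕ y ≤ toℕ z) → m < ℓ → h + ℓ ≤ n →
  survSum n h m ℓ U ≡ fromℕ (countPrefixWith (allFin (n + h)) (h + ℓ) U z (h + m))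
surviving-mass n h m ℓ U z z∈U z-max m<ℓ h+ℓ≤n =
  sumℚ-fromℕ _ _ (perms C) (All.map summand (perms-↭ C))
  where
  open Survival n m
  C = allFin (n + h)
  indicator : ∀ b → (if b then 1ℚ else 0ℚ) ≡ fromℕ (ind b)
  indicator true = refl
  indicator false = refl
  unique : ∀ {w} → w ↭ C → Unique w
  unique w↭ = PermSetoid.Unique-resp-↭ (setoid (Fin (n + h))) (↭⇒↭ₛ (↭-sym w↭)) (allFin⁺ (n + h))
  long : ∀ {w} → w ↭ C → h + ℓ ≤ length w
  long w↭ = subst (h + ℓ ≤_) (sym (trans (↭-length w↭) (ListP.length-tabulate (λ i → i))))
                  (ℕP.≤-trans h+ℓ≤n (ℕP.m≤m+n n h))
  max-in-prefix : ∀ {w} → prefix (h + ℓ) w ≡ U → z IsMaxOf take (h + ℓ) w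
  max-in-prefix {w} S≡U = setOf⁻ (take (h + ℓ) w) (subst (z ∈_) (sym S≡U) z∈U)
                        , λ y∈ → z-max (subst (_ ∈_) S≡U (setOf⁺ (take (h + ℓ) w) y∈))
  summand : ∀ {w} → w ↭ C →
    (if Sset h ℓ w ≟ˢ U then survive n m 1 (setOf (take h w)) (drop h w) ℓ else 0ℚ)
      ≡ fromℕ (ind ((prefix (h + ℓ) w ≟ˢ U) ∧ memb z (prefix (h + m) w)))
  summand {w} w↭ with Sset h ℓ w ≟ˢ U in S≟U
  ... | false = refl
  ... | true = trans (survival-indicator h ℓ w z (unique w↭) m<ℓ h+ℓ≤n (long w↭) (max-in-prefix (≟ˢ-sound S≟U)))
                     (indicator (memb z (prefix (h + m) w)))

open import Data.Rational using (_*_)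

lemma2 : (n h m ℓ : ℕ) → 1 ≤ n → h ≤ n ∸ 1 → m + 1 ≤ ℓ → ℓ ≤ n ∸ h →
    (U : Subset (n + h)) → ∣ U ∣ ≡ h + ℓ →
    fromℕ (h + ℓ) * survSum n h m ℓ U ≡ fromℕ (h + m) * fromℕ (countS n h ℓ U)
lemma2 n h m ℓ _ h≤n-1 m+1≤ℓ ℓ≤n-h U ∣U∣≡h+ℓ with greatest U (nonempty-of-card U U-positive)
  where
  U-positive : 0 < ∣ U ∣
  U-positive = subst (0 <_) (sym ∣U∣≡h+ℓ) (ℕP.≤-trans (ℕP.m≤n+m 1 m) (ℕP.≤-trans m+1≤ℓ (ℕP.m≤n+m ℓ h)))
... | z , z∈U , z-max = begin
    fromℕ (h + ℓ) * survSum n h m ℓ U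
  ≡⟨ cong (fromℕ (h + ℓ) *_) (surviving-mass n h m ℓ U z z∈U z-max m<ℓ h+ℓ≤n) ⟩
    fromℕ (h + ℓ) * fromℕ (countPrefixWith C (h + ℓ) U z (h + m))
  ≡⟨ sym (fromℕ-* (h + ℓ) _) ⟩
    fromℕ ((h + ℓ) ℕ.* countPrefixWith C (h + ℓ) U z (h + m))
  ≡⟨ cong fromℕ (position-uniform C (allFin⁺ (n + h)) (h + ℓ) U z (h + m) h+ℓ≤∣C∣ z∈U h+m≤h+ℓ) ⟩
    fromℕ ((h + m) ℕ.* countPrefix C (h + ℓ) U)
  ≡⟨ fromℕ-* (h + m) _ ⟩
    fromℕ (h + m) * fromℕ (countPrefix C (h + ℓ) U)
  ≡⟨ cong (λ k → fromℕ (h + m) * fromℕ k) (sym (length-filter _ (perms C))) ⟩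
    fromℕ (h + m) * fromℕ (countS n h ℓ U)
  ∎
  where
  open ≡-Reasoning
  C = allFin (n + h)
  m<ℓ : m < ℓ
  m<ℓ = subst (_≤ ℓ) (ℕP.+-comm m 1) m+1≤ℓ
  h+m≤h+ℓ : h + m ≤ h + ℓ
  h+m≤h+ℓ = ℕP.+-monoʳ-≤ h (ℕP.<⇒≤ m<ℓ)
  h+ℓ≤n : h + ℓ ≤ n
  h+ℓ≤n = ℕP.≤-trans (ℕP.+-monoʳ-≤ h ℓ≤n-h) (ℕP.≤-reflexive (ℕP.m+[n∸m]≡n (ℕP.≤-trans h≤n-1 (ℕP.m∸n≤m n 1))))
  h+ℓ≤∣C∣ : h + ℓ ≤ length C
  h+ℓ≤∣C∣ = subst (h + ℓ ≤_) (sym (ListP.length-tabulate (λ i → i))) (ℕP.≤-trans h+ℓ≤n (ℕP.m≤m+n n h))
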